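{- Let $G=(\{1,2,\dots,v\},E)$ be a simple graph with $v\ge 1$ vertices and $e=|E|\ge 0$ edges, and let $\lambda\ge 1$ be an integer. Then the number $|C^p|$ of proper $\lambda$-colorings of $G$ satisfies $$|C^p|\le \lambda^v\cdot\frac{\lambda-1}{e+\lambda-1},$$ where in the case $\lambda=1$ and $e=0$ the fraction $0/0$ is interpreted as $1$.
   Context: A $\lambda$-coloring of $G$ is any map from the vertex set $\{1,\dots,v\}$ to a fixed set $L$ of $\lambda$ colors; it is proper if no edge of $G$ has both endpoints of the same color. -}

module Defs where

open import Data.Nat using (ℕ; zero; suc)
open import Data.Fin using (Fin; toℕ)
open import Data.Vec using (Vec; []; _∷_; lookup)
open import Data.List using (List; []; _∷_; concatMap; map; filter; length)
open import Data.List.Relation.Unary.All using (All; all?)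
open import Data.List.Relation.Unary.Unique.Propositional using (Unique)
open import Data.Product using (_×_; _,_)
open import Data.Fin.Properties using (_≟_)
open import Relation.Nullary using (¬_; Dec)
open import Relation.Nullary.Decidable using (¬?)
open import Relation.Binary.PropositionalEquality using (_≡_)
import Data.Fin as F

-- A simple graph on the vertex set Fin v (vertices 1..v): a duplicate-free
-- list of edges, each edge {i,j} stored once as the pair (i , j) with i < j
-- (so no loops, no multiple edges, undirected).
record SimpleGraph (v : ℕ) : Set where
  field
    edges    : List (Fin v × Fin v)
    ordered  : All (λ { (i , j) → i F.< j }) edges
    distinct : Unique edges

open SimpleGraph public

numEdges : ∀ {v} → SimpleGraph v → ℕ
numEdges G = length (edges G)

Coloring : ℕ → ℕ → Set
Coloring q v = Vec (Fin q) v

allColorings : (q v : ℕ) → List (Coloring q v)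
allColorings q zero = [] ∷ []
allColorings q (suc v) =
  concatMap (λ c → map (c ∷_) (allColorings q v)) (Data.List.allFin q)

Proper : ∀ {q v} → SimpleGraph v → Coloring q v → Set
Proper G c = All (λ { (i , j) → ¬ (lookup c i ≡ lookup c j) }) (edges G)

proper? : ∀ {q v} (G : SimpleGraph v) (c : Coloring q v) → Dec (Proper G c)
proper? G c = all? (λ { (i , j) → ¬? (lookup c i ≟ lookup c j) }) (edges G)

numProper : ∀ {v} → (q : ℕ) → SimpleGraph v → ℕ
numProper {v} q G = length (filter (proper? G) (allColorings q v))

{-# OPTIONS --safe #-}
-- For a uniformly random colouring let Y be its number of monochromatic edges and X = q Y.
-- An edge is monochromatic with probability 1/q, and for two distinct edges these events are
-- independent: one edge has an endpoint outside the other, and recolouring that vertex alone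
-- decides whether the first edge is monochromatic. Hence, with m = e + q - 1, E X = e and E X² = e m.
-- Proper colourings have X = 0, and pointwise [X = 0] m² + 2 m X ≤ m² + X² (AM-GM), so averaging
-- gives Pr[X = 0] m² + 2 m e ≤ m² + e m, that is Pr[X = 0] ≤ (q - 1) / m. Probabilities are kept
-- as counts over the q ^ v colourings.
module Submission where

open import Defs
open import Data.Nat using (ℕ; _+_; _*_; _∸_; _^_; _≤_; _≥_; zero; suc; z≤n)
open import Data.Nat.Properties
open import Data.Nat.Tactic.RingSolver using (solve-∀)
open import Algebra.Properties.CommutativeSemigroup +-commutativeSemigroup
  using () renaming (interchange to +-interchange; xy∙z≈xz∙y to +-right-exchange)
open import Data.Fin as Fin using (Fin)
import Data.Fin.Properties as Finₚ
open import Data.Vec using (_∷_; lookup; _[_]≔_)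
open import Data.Vec.Properties using (lookup∘update; lookup∘update′)
open import Data.List using (List; []; _∷_; _++_; map; concatMap; filter; length; allFin)
open import Data.List.Properties using (length-tabulate; length-filter)
open import Data.List.Relation.Unary.All as All using (All; []; _∷_)
open import Data.List.Relation.Unary.Any using (here; there)
open import Data.List.Relation.Unary.AllPairs using (_∷_)
open import Data.List.Relation.Unary.Unique.Propositional using (Unique)
open import Data.List.Relation.Unary.Unique.Propositional.Properties using (allFin⁺)
open import Data.List.Membership.Propositional using (_∈_)
open import Data.List.Membership.Propositional.Properties using (∈-allFin)
open import Data.Product using (_×_; _,_)
open import Data.Sum using (_⊎_; inj₁; inj₂; [_,_]′)
open import Function using (_∘_; flip)
open import Relation.Nullary using (Dec; yes; no; ¬_)
open import Relation.Unary using (Decidable)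
open import Relation.Binary.PropositionalEquality
  using (_≡_; _≢_; refl; sym; trans; cong; cong₂; subst; subst₂; ≢-sym; module ≡-Reasoning)
open import Data.Empty using (⊥-elim)

private
  variable
    A B : Set
    v : ℕ

∑ : List A → (A → ℕ) → ℕ
∑ []       f = 0
∑ (x ∷ xs) f = f x + ∑ xs f

infix 5 ∑
syntax ∑ xs (λ x → e) = ∑[ x ∈ xs ] e

∑-cong : (xs : List A) {f g : A → ℕ} → (∀ x → f x ≡ g x) → ∑ xs f ≡ ∑ xs g
∑-cong []       f≡g = refl
∑-cong (x ∷ xs) f≡g = cong₂ _+_ (f≡g x) (∑-cong xs f≡g)

∑-mono-≤ : (xs : List A) {f g : A → ℕ} → (∀ x → f x ≤ g x) → ∑ xs f ≤ ∑ xs g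
∑-mono-≤ []       f≤g = z≤n
∑-mono-≤ (x ∷ xs) f≤g = +-mono-≤ (f≤g x) (∑-mono-≤ xs f≤g)

∑-++ : (xs ys : List A) (f : A → ℕ) → ∑ (xs ++ ys) f ≡ ∑ xs f + ∑ ys f
∑-++ []       ys f = refl
∑-++ (x ∷ xs) ys f = trans (cong (f x +_) (∑-++ xs ys f)) (sym (+-assoc (f x) _ _))

∑-+ : (xs : List A) (f g : A → ℕ) → ∑[ x ∈ xs ] (f x + g x) ≡ ∑ xs f + ∑ xs g
∑-+ []       f g = refl
∑-+ (x ∷ xs) f g = trans (cong (f x + g x +_) (∑-+ xs f g))
                         (+-interchange (f x) (g x) (∑ xs f) (∑ xs g))

∑-*ˡ : (k : ℕ) (xs : List A) (f : A → ℕ) → k * ∑ xs f ≡ ∑[ x ∈ xs ] k * f x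
∑-*ˡ k []       f = *-zeroʳ k
∑-*ˡ k (x ∷ xs) f = trans (*-distribˡ-+ k (f x) _) (cong (k * f x +_) (∑-*ˡ k xs f))

∑-*ʳ : (k : ℕ) (xs : List A) (f : A → ℕ) → ∑ xs f * k ≡ ∑[ x ∈ xs ] f x * k
∑-*ʳ k xs f = trans (*-comm _ k) (trans (∑-*ˡ k xs f) (∑-cong xs (λ x → *-comm k (f x))))

∑-constant : {xs : List A} {f : A → ℕ} {k : ℕ} → All (λ x → f x ≡ k) xs → ∑ xs f ≡ length xs * k
∑-constant []           = refl
∑-constant (fx≡k ∷ f≡k) = cong₂ _+_ fx≡k (∑-constant f≡k)

∑-const : (xs : List A) (k : ℕ) → ∑[ _ ∈ xs ] k ≡ length xs * k
∑-const xs k = ∑-constant (All.universal (λ _ → refl) xs)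

∑-1≡length : (xs : List A) → ∑[ _ ∈ xs ] 1 ≡ length xs
∑-1≡length xs = trans (∑-const xs 1) (*-identityʳ (length xs))

∑-all-but-one : {xs : List A} {x : A} {f : A → ℕ} {b d : ℕ} → Unique xs → x ∈ xs →
  (∀ {y} → y ∈ xs → y ≢ x → f y ≡ b) → f x ≡ b + d → ∑ xs f ≡ length xs * b + d
∑-all-but-one {xs = x ∷ xs} {f = f} {b} {d} (x∉xs ∷ _) (here refl) f≡b fx≡b+d =
  trans (cong₂ _+_ fx≡b+d (∑-constant (All.tabulate λ y∈xs →
                             f≡b (there y∈xs) (≢-sym (All.lookup x∉xs y∈xs)))))
        (+-right-exchange b d (length xs * b))
∑-all-but-one {xs = y ∷ xs} {b = b} {d} (y∉xs ∷ unique) (there x∈xs) f≡b fx≡b+d =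
  trans (cong₂ _+_ (f≡b (here refl) (All.lookup y∉xs x∈xs))
                   (∑-all-but-one unique x∈xs (f≡b ∘ there) fx≡b+d))
        (sym (+-assoc b (length xs * b) d))

∑-map : (g : A → B) (xs : List A) (f : B → ℕ) → ∑ (map g xs) f ≡ ∑ xs (f ∘ g)
∑-map g []       f = refl
∑-map g (x ∷ xs) f = cong (f (g x) +_) (∑-map g xs f)

∑-concatMap : (g : A → List B) (xs : List A) (f : B → ℕ) →
  ∑ (concatMap g xs) f ≡ ∑[ x ∈ xs ] ∑ (g x) f
∑-concatMap g []       f = refl
∑-concatMap g (x ∷ xs) f =
  trans (∑-++ (g x) (concatMap g xs) f) (cong (∑ (g x) f +_) (∑-concatMap g xs f))

∑-swap : (xs : List A) (ys : List B) (f : A → B → ℕ) →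
  ∑[ x ∈ xs ] ∑[ y ∈ ys ] f x y ≡ ∑[ y ∈ ys ] ∑[ x ∈ xs ] f x y
∑-swap []       ys f = sym (trans (∑-const ys 0) (*-zeroʳ (length ys)))
∑-swap (x ∷ xs) ys f =
  trans (cong (∑ ys (f x) +_) (∑-swap xs ys f)) (sym (∑-+ ys (f x) _))

∑-*-∑ : (xs : List A) (ys : List B) (f : A → ℕ) (g : B → ℕ) →
  ∑ xs f * ∑ ys g ≡ ∑[ x ∈ xs ] ∑[ y ∈ ys ] f x * g y
∑-*-∑ xs ys f g = trans (∑-*ʳ (∑ ys g) xs f) (∑-cong xs (λ x → ∑-*ˡ (f x) ys g))

∑-allFin-const : (q k : ℕ) → ∑[ _ ∈ allFin q ] k ≡ q * k
∑-allFin-const q k = trans (∑-const (allFin q) k) (cong (_* k) (length-tabulate {n = q} (λ i → i)))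

indicator : {P : Set} → Dec P → ℕ
indicator (yes _) = 1
indicator (no _)  = 0

module _ {P : Set} where
  indicator-yes : P → (p? : Dec P) → indicator p? ≡ 1
  indicator-yes p (yes _) = refl
  indicator-yes p (no ¬p) = ⊥-elim (¬p p)

  indicator-no : ¬ P → (p? : Dec P) → indicator p? ≡ 0
  indicator-no ¬p (yes p) = ⊥-elim (¬p p)
  indicator-no ¬p (no _)  = refl

  indicator-idem : (p? : Dec P) → indicator p? * indicator p? ≡ indicator p?
  indicator-idem (yes _) = refl
  indicator-idem (no _)  = refl

2*m*n≤m*m+n*n : (m n : ℕ) → 2 * m * n ≤ m * m + n * n
2*m*n≤m*m+n*n m n =
  [ ≤-case , (λ n≤m → subst₂ _≤_ (swap n m) (+-comm (n * n) (m * m)) (≤-case n≤m)) ]′ (≤-total m n)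
  where
  square : ∀ a d → 2 * a * (a + d) + d * d ≡ a * a + (a + d) * (a + d)
  square = solve-∀
  swap : ∀ a b → 2 * a * b ≡ 2 * b * a
  swap = solve-∀
  ≤-case : {a b : ℕ} → a ≤ b → 2 * a * b ≤ a * a + b * b
  ≤-case {a} a≤b with d , refl ← m≤n⇒∃[o]m+o≡n a≤b =
    subst (2 * a * (a + d) ≤_) (square a d) (m≤m+n _ (d * d))

indicator-moment : {P : Set} (m x : ℕ) → (P → x ≡ 0) → (p? : Dec P) →
  indicator p? * (m * m) + 2 * m * x ≤ m * m + x * x
indicator-moment m x x≡0 (yes p) rewrite x≡0 p =
  ≤-reflexive (cong₂ _+_ (*-identityˡ (m * m)) (*-zeroʳ (2 * m)))
indicator-moment m x x≡0 (no _)  = 2*m*n≤m*m+n*n m x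

moment-inequality⇒bound : (F N e r : ℕ) → let m = e + r in
  F * (m * m) + 2 * m * (e * N) ≤ N * (m * m) + e * (m * N) → F * m ≤ N * r
moment-inequality⇒bound F N e r ineq with e + r in m≡e+r
... | zero      = subst (_≤ N * r) (sym (*-zeroʳ F)) z≤n
... | m@(suc _) = +-cancelʳ-≤ (e * N) (F * m) (N * r) (begin
  F * m + e * N ≤⟨ *-cancelˡ-≤ m (+-cancelʳ-≤ (m * (e * N)) _ _ (begin
                     m * (F * m + e * N) + m * (e * N) ≡⟨ lhs F N e m ⟨
                     F * (m * m) + 2 * m * (e * N)     ≤⟨ ineq ⟩
                     N * (m * m) + e * (m * N)         ≡⟨ rhs N e m ⟩
                     m * (N * m) + m * (e * N)         ∎)) ⟩
  N * m           ≡⟨ cong (N *_) m≡e+r ⟨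
  N * (e + r)     ≡⟨ distrib N e r ⟩
  N * r + e * N   ∎)
  where
  open ≤-Reasoning
  lhs : ∀ F N e m → F * (m * m) + 2 * m * (e * N) ≡ m * (F * m + e * N) + m * (e * N)
  lhs = solve-∀
  rhs : ∀ N e m → N * (m * m) + e * (m * N) ≡ m * (N * m) + m * (e * N)
  rhs = solve-∀
  distrib : ∀ N e r → N * (e + r) ≡ N * r + e * N
  distrib = solve-∀

module _ {A : Set} {P : A → Set} (P? : Decidable P) where
  length-filter≡∑indicator : (xs : List A) → length (filter P? xs) ≡ ∑[ x ∈ xs ] indicator (P? x)
  length-filter≡∑indicator []       = refl
  length-filter≡∑indicator (x ∷ xs) with P? x
  ... | yes _ = cong suc (length-filter≡∑indicator xs)
  ... | no _  = length-filter≡∑indicator xs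

  second-moment-bound : (xs : List A) (X : A → ℕ) {N e r : ℕ} → length xs ≡ N →
    (∀ {x} → P x → X x ≡ 0) → ∑ xs X ≡ e * N → ∑[ x ∈ xs ] X x * X x ≡ e * ((e + r) * N) →
    length (filter P? xs) * (e + r) ≤ N * r
  second-moment-bound xs X {N} {e} {r} length≡N X≡0 first second =
    moment-inequality⇒bound F N e r (begin
      F * (m * m) + 2 * m * (e * N)
        ≡⟨ cong₂ _+_ (cong (_* (m * m)) (length-filter≡∑indicator xs)) (cong (2 * m *_) (sym first)) ⟩
      (∑[ x ∈ xs ] indicator (P? x)) * (m * m) + 2 * m * ∑ xs X
        ≡⟨ cong₂ _+_ (∑-*ʳ (m * m) xs _) (∑-*ˡ (2 * m) xs X) ⟩
      (∑[ x ∈ xs ] indicator (P? x) * (m * m)) + (∑[ x ∈ xs ] 2 * m * X x)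
        ≡⟨ ∑-+ xs _ _ ⟨
      ∑[ x ∈ xs ] indicator (P? x) * (m * m) + 2 * m * X x
        ≤⟨ ∑-mono-≤ xs (λ x → indicator-moment m (X x) X≡0 (P? x)) ⟩
      ∑[ x ∈ xs ] m * m + X x * X x
        ≡⟨ ∑-+ xs _ _ ⟩
      (∑[ _ ∈ xs ] m * m) + (∑[ x ∈ xs ] X x * X x)
        ≡⟨ cong₂ _+_ (trans (∑-const xs (m * m)) (cong (_* (m * m)) length≡N)) second ⟩
      N * (m * m) + e * (m * N) ∎)
    where
    open ≤-Reasoning
    F : ℕ
    F = length (filter P? xs)
    m : ℕ
    m = e + r

δ : {q : ℕ} → Fin q → Fin q → ℕ
δ a b = indicator (a Finₚ.≟ b)

δ-sym : {q : ℕ} (a b : Fin q) → δ a b ≡ δ b a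
δ-sym a b with a Finₚ.≟ b | b Finₚ.≟ a
... | yes _   | yes _   = refl
... | no _    | no _    = refl
... | yes a≡b | no b≢a  = ⊥-elim (b≢a (sym a≡b))
... | no a≢b  | yes b≡a = ⊥-elim (a≢b (sym b≡a))

∑-δ : {q : ℕ} (b : Fin q) → ∑[ a ∈ allFin q ] δ a b ≡ 1
∑-δ {q} b = trans (∑-all-but-one (allFin⁺ q) (∈-allFin b)
                                 (λ {a} _ a≢b → indicator-no a≢b (a Finₚ.≟ b))
                                 (indicator-yes refl (b Finₚ.≟ b)))
                  (cong (_+ 1) (*-zeroʳ (length (allFin q))))

∑-allColorings-suc : (q v : ℕ) (f : Coloring q (suc v) → ℕ) →
  ∑ (allColorings q (suc v)) f ≡ ∑[ a ∈ allFin q ] ∑[ c ∈ allColorings q v ] f (a ∷ c)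
∑-allColorings-suc q v f =
  trans (∑-concatMap (λ a → map (a ∷_) (allColorings q v)) (allFin q) f)
        (∑-cong (allFin q) (λ a → ∑-map (a ∷_) (allColorings q v) f))

length-allColorings : (q v : ℕ) → length (allColorings q v) ≡ q ^ v
length-allColorings q zero    = refl
length-allColorings q (suc v) = begin
  length (allColorings q (suc v))
    ≡⟨ ∑-1≡length (allColorings q (suc v)) ⟨
  ∑[ _ ∈ allColorings q (suc v) ] 1
    ≡⟨ ∑-allColorings-suc q v (λ _ → 1) ⟩
  ∑[ _ ∈ allFin q ] ∑[ _ ∈ allColorings q v ] 1
    ≡⟨ ∑-cong (allFin q) (λ _ → trans (∑-1≡length (allColorings q v)) (length-allColorings q v)) ⟩
  ∑[ _ ∈ allFin q ] q ^ v
    ≡⟨ ∑-allFin-const q (q ^ v) ⟩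
  q * q ^ v ∎
  where open ≡-Reasoning

∑-update : {q : ℕ} (j : Fin v) (f : Coloring q v → ℕ) →
  q * ∑ (allColorings q v) f ≡ ∑[ c ∈ allColorings q v ] ∑[ a ∈ allFin q ] f (c [ j ]≔ a)
∑-update {suc v} {q} Fin.zero f = begin
  q * ∑ (allColorings q (suc v)) f                         ≡⟨ cong (q *_) (∑-allColorings-suc q v f) ⟩
  q * (∑[ a ∈ allFin q ] ∑[ c ∈ allColorings q v ] f (a ∷ c)) ≡⟨ sym (∑-allFin-const q _) ⟩
  ∑[ _ ∈ allFin q ] ∑[ a ∈ allFin q ] ∑[ c ∈ allColorings q v ] f (a ∷ c)
    ≡⟨ ∑-cong (allFin q) (λ _ → ∑-swap (allFin q) (allColorings q v) (λ a c → f (a ∷ c))) ⟩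
  ∑[ _ ∈ allFin q ] ∑[ c ∈ allColorings q v ] ∑[ a ∈ allFin q ] f (a ∷ c)
    ≡⟨ sym (∑-allColorings-suc q v _) ⟩
  ∑[ c ∈ allColorings q (suc v) ] ∑[ a ∈ allFin q ] f (c [ Fin.zero ]≔ a) ∎
  where open ≡-Reasoning
∑-update {suc v} {q} (Fin.suc j) f = begin
  q * ∑ (allColorings q (suc v)) f                         ≡⟨ cong (q *_) (∑-allColorings-suc q v f) ⟩
  q * (∑[ b ∈ allFin q ] ∑[ c ∈ allColorings q v ] f (b ∷ c)) ≡⟨ ∑-*ˡ q (allFin q) _ ⟩
  ∑[ b ∈ allFin q ] q * (∑[ c ∈ allColorings q v ] f (b ∷ c))
    ≡⟨ ∑-cong (allFin q) (λ b → ∑-update j (λ c → f (b ∷ c))) ⟩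
  ∑[ b ∈ allFin q ] ∑[ c ∈ allColorings q v ] ∑[ a ∈ allFin q ] f (b ∷ (c [ j ]≔ a))
    ≡⟨ sym (∑-allColorings-suc q v _) ⟩
  ∑[ c ∈ allColorings q (suc v) ] ∑[ a ∈ allFin q ] f (c [ Fin.suc j ]≔ a) ∎
  where open ≡-Reasoning

∑-δ-independent : {q : ℕ} {x y : Fin v} (g : Coloring q v → ℕ) →
  x ≢ y → (∀ c a → g (c [ x ]≔ a) ≡ g c) →
  q * (∑[ c ∈ allColorings q v ] δ (lookup c x) (lookup c y) * g c) ≡ ∑ (allColorings q v) g
∑-δ-independent {v} {q} {x} {y} g x≢y g-indep = begin
  q * (∑[ c ∈ cs ] δ (lookup c x) (lookup c y) * g c)
    ≡⟨ ∑-update x _ ⟩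
  ∑[ c ∈ cs ] ∑[ a ∈ allFin q ] δ (lookup (c [ x ]≔ a) x) (lookup (c [ x ]≔ a) y) * g (c [ x ]≔ a)
    ≡⟨ ∑-cong cs (λ c → ∑-cong (allFin q) (λ a → cong₂ _*_
         (cong₂ δ (lookup∘update x c a) (lookup∘update′ (≢-sym x≢y) c a)) (g-indep c a))) ⟩
  ∑[ c ∈ cs ] ∑[ a ∈ allFin q ] δ a (lookup c y) * g c
    ≡⟨ ∑-cong cs (λ c → sym (∑-*ʳ (g c) (allFin q) _)) ⟩
  ∑[ c ∈ cs ] (∑[ a ∈ allFin q ] δ a (lookup c y)) * g c
    ≡⟨ ∑-cong cs (λ c → trans (cong (_* g c) (∑-δ (lookup c y))) (*-identityˡ (g c))) ⟩
  ∑ cs g ∎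
  where
  open ≡-Reasoning
  cs : List (Coloring q v)
  cs = allColorings q v

Ordered : Fin v × Fin v → Set
Ordered (i , j) = i Fin.< j

monochromatic : {q : ℕ} → Fin v × Fin v → Coloring q v → ℕ
monochromatic (i , j) c = δ (lookup c i) (lookup c j)

monochromaticEdges : {q : ℕ} → List (Fin v × Fin v) → Coloring q v → ℕ
monochromaticEdges es c = ∑[ f ∈ es ] monochromatic f c

monochromatic-update : {q : ℕ} {x k l : Fin v} → x ≢ k → x ≢ l → (c : Coloring q v) (a : Fin q) →
  monochromatic (k , l) (c [ x ]≔ a) ≡ monochromatic (k , l) c
monochromatic-update x≢k x≢l c a =
  cong₂ δ (lookup∘update′ (≢-sym x≢k) c a) (lookup∘update′ (≢-sym x≢l) c a)

∑-monochromatic : {q : ℕ} {i j : Fin v} → i ≢ j →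
  q * ∑ (allColorings q v) (monochromatic (i , j)) ≡ q ^ v
∑-monochromatic {v} {q} {i} {j} i≢j = begin
  q * ∑ cs (monochromatic (i , j))               ≡⟨ cong (q *_) (∑-cong cs (λ c → sym (*-identityʳ _))) ⟩
  q * (∑[ c ∈ cs ] monochromatic (i , j) c * 1) ≡⟨ ∑-δ-independent (λ _ → 1) i≢j (λ _ _ → refl) ⟩
  ∑[ _ ∈ cs ] 1                                  ≡⟨ ∑-1≡length cs ⟩
  length cs                                      ≡⟨ length-allColorings q v ⟩
  q ^ v                                          ∎
  where
  open ≡-Reasoning
  cs : List (Coloring q v)
  cs = allColorings q v

∑-monochromatic-pair-disjoint : {q : ℕ} {x y k l : Fin v} → x ≢ y → k ≢ l → x ≢ k → x ≢ l →
  q * q * (∑[ c ∈ allColorings q v ] monochromatic (x , y) c * monochromatic (k , l) c) ≡ q ^ v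
∑-monochromatic-pair-disjoint {v} {q} {x} {y} {k} {l} x≢y k≢l x≢k x≢l = begin
  q * q * (∑[ c ∈ cs ] monochromatic (x , y) c * monochromatic (k , l) c)
    ≡⟨ *-assoc q q _ ⟩
  q * (q * (∑[ c ∈ cs ] monochromatic (x , y) c * monochromatic (k , l) c))
    ≡⟨ cong (q *_) (∑-δ-independent (monochromatic (k , l)) x≢y (monochromatic-update x≢k x≢l)) ⟩
  q * ∑ cs (monochromatic (k , l))
    ≡⟨ ∑-monochromatic k≢l ⟩
  q ^ v ∎
  where
  open ≡-Reasoning
  cs : List (Coloring q v)
  cs = allColorings q v

freeEndpoint : {i j k l : Fin v} → i Fin.< j → k Fin.< l → (i , j) ≢ (k , l) →
  (i ≢ k × i ≢ l) ⊎ (j ≢ k × j ≢ l)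
freeEndpoint {i = i} {k = k} {l} i<j k<l ij≢kl with i Finₚ.≟ k | i Finₚ.≟ l
... | no i≢k   | no i≢l   = inj₁ (i≢k , i≢l)
... | yes refl | _        = inj₂ (≢-sym (Finₚ.<⇒≢ i<j) , λ j≡l → ij≢kl (cong (i ,_) j≡l))
... | no _     | yes refl = inj₂ ((λ { refl → Finₚ.<-asym i<j k<l }) , ≢-sym (Finₚ.<⇒≢ i<j))

∑-monochromatic-pair : {q : ℕ} {i j k l : Fin v} → i Fin.< j → k Fin.< l → (i , j) ≢ (k , l) →
  q * q * (∑[ c ∈ allColorings q v ] monochromatic (i , j) c * monochromatic (k , l) c) ≡ q ^ v
∑-monochromatic-pair {v} {q} {i} {j} i<j k<l ij≢kl with freeEndpoint i<j k<l ij≢kl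
... | inj₁ (i≢k , i≢l) = ∑-monochromatic-pair-disjoint (Finₚ.<⇒≢ i<j) (Finₚ.<⇒≢ k<l) i≢k i≢l
... | inj₂ (j≢k , j≢l) =
  trans (cong (q * q *_) (∑-cong (allColorings q v) (λ c → cong (_* _) (δ-sym (lookup c i) (lookup c j)))))
        (∑-monochromatic-pair-disjoint (≢-sym (Finₚ.<⇒≢ i<j)) (Finₚ.<⇒≢ k<l) j≢k j≢l)

∑-monochromaticEdges : {q : ℕ} {es : List (Fin v × Fin v)} → All Ordered es →
  q * ∑ (allColorings q v) (monochromaticEdges es) ≡ length es * q ^ v
∑-monochromaticEdges {v} {q} {es} ordered = begin
  q * (∑[ c ∈ cs ] ∑[ f ∈ es ] monochromatic f c) ≡⟨ cong (q *_) (∑-swap cs es _) ⟩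
  q * (∑[ f ∈ es ] ∑[ c ∈ cs ] monochromatic f c) ≡⟨ ∑-*ˡ q es _ ⟩
  ∑[ f ∈ es ] q * ∑ cs (monochromatic f)          ≡⟨ ∑-constant (All.map (λ i<j →
                                                         ∑-monochromatic (Finₚ.<⇒≢ i<j)) ordered) ⟩
  length es * q ^ v                                ∎
  where
  open ≡-Reasoning
  cs : List (Coloring q v)
  cs = allColorings q v

∑-monochromaticEdges² : (q' : ℕ) {es : List (Fin v × Fin v)} → Unique es → All Ordered es →
  let q = suc q' in
  q * q * (∑[ c ∈ allColorings q v ] monochromaticEdges es c * monochromaticEdges es c)
    ≡ length es * ((length es + q') * q ^ v)
∑-monochromaticEdges² {v} q' {es} unique ordered = begin
  q * q * (∑[ c ∈ cs ] Y c * Y c)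
    ≡⟨ cong (q * q *_) (∑-cong cs (λ c → ∑-*-∑ es es (flip monochromatic c) (flip monochromatic c))) ⟩
  q * q * (∑[ c ∈ cs ] ∑[ f ∈ es ] ∑[ g ∈ es ] monochromatic f c * monochromatic g c)
    ≡⟨ cong (q * q *_) (trans (∑-swap cs es _) (∑-cong es (λ f → ∑-swap cs es _))) ⟩
  q * q * (∑[ f ∈ es ] ∑[ g ∈ es ] joint f g)
    ≡⟨ ∑-*ˡ (q * q) es _ ⟩
  ∑[ f ∈ es ] q * q * (∑[ g ∈ es ] joint f g)
    ≡⟨ ∑-constant (All.tabulate row) ⟩
  e * (e * N + q' * N)
    ≡⟨ cong (e *_) (sym (*-distribʳ-+ N e q')) ⟩
  e * ((e + q') * N) ∎
  where
  open ≡-Reasoning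
  q : ℕ
  q = suc q'
  cs : List (Coloring q v)
  cs = allColorings q v
  N : ℕ
  N = q ^ v
  e : ℕ
  e = length es
  Y : Coloring q v → ℕ
  Y = monochromaticEdges es
  joint : Fin v × Fin v → Fin v × Fin v → ℕ
  joint f g = ∑[ c ∈ cs ] monochromatic f c * monochromatic g c

  diagonal : {i j : Fin v} → i ≢ j → q * q * joint (i , j) (i , j) ≡ N + q' * N
  diagonal {i} {j} i≢j = begin
    q * q * joint (i , j) (i , j)
      ≡⟨ cong (q * q *_) (∑-cong cs (λ c → indicator-idem (lookup c i Finₚ.≟ lookup c j))) ⟩
    q * q * ∑ cs (monochromatic (i , j)) ≡⟨ *-assoc q q _ ⟩
    q * (q * ∑ cs (monochromatic (i , j))) ≡⟨ cong (q *_) (∑-monochromatic i≢j) ⟩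
    q * N ∎

  row : {f : Fin v × Fin v} → f ∈ es → q * q * (∑[ g ∈ es ] joint f g) ≡ e * N + q' * N
  row {i , j} f∈es = trans (∑-*ˡ (q * q) es _)
    (∑-all-but-one unique f∈es
      (λ g∈es g≢f → ∑-monochromatic-pair i<j (All.lookup ordered g∈es) (≢-sym g≢f))
      (diagonal (Finₚ.<⇒≢ i<j)))
    where
    i<j : i Fin.< j
    i<j = All.lookup ordered f∈es

proper⇒monochromaticEdges≡0 : {q : ℕ} (G : SimpleGraph v) (c : Coloring q v) → Proper G c →
  monochromaticEdges (edges G) c ≡ 0
proper⇒monochromaticEdges≡0 G c proper =
  trans (∑-constant (All.map (λ cᵢ≢cⱼ → indicator-no cᵢ≢cⱼ _) proper)) (*-zeroʳ (numEdges G))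

numProper-bound : (G : SimpleGraph v) (q' : ℕ) →
  numProper (suc q') G * (numEdges G + q') ≤ suc q' ^ v * q'
numProper-bound {v} G q' =
  second-moment-bound (proper? G) cs X (length-allColorings q v)
    (λ {c} proper → trans (cong (q *_) (proper⇒monochromaticEdges≡0 G c proper)) (*-zeroʳ q))
    (trans (sym (∑-*ˡ q cs Y)) (∑-monochromaticEdges edgesOrdered))
    (trans (∑-cong cs (λ c → square-scaled q (Y c)))
           (trans (sym (∑-*ˡ (q * q) cs _)) (∑-monochromaticEdges² q' (distinct G) edgesOrdered)))
  where
  q : ℕ
  q = suc q'
  cs : List (Coloring q v)
  cs = allColorings q v
  Y : Coloring q v → ℕ
  Y = monochromaticEdges (edges G)
  X : Coloring q v → ℕ
  X c = q * Y c
  edgesOrdered : All Ordered (edges G)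
  edgesOrdered = ordered G
  square-scaled : ∀ q y → (q * y) * (q * y) ≡ q * q * (y * y)
  square-scaled = solve-∀

mainTheorem1 : (v : ℕ) → v ≥ 1 → (G : SimpleGraph v) → (q : ℕ) → q ≥ 1 →
    ((numEdges G + q ∸ 1 ≡ 0 → numProper q G ≤ q ^ v) ×
     (numEdges G + q ∸ 1 ≢ 0 →
       numProper q G * (numEdges G + q ∸ 1) ≤ q ^ v * (q ∸ 1)))
mainTheorem1 v _ G (suc q') _ = (λ _ → numProper≤q^v) , (λ _ → bound)
  where
  q : ℕ
  q = suc q'
  numProper≤q^v : numProper q G ≤ q ^ v
  numProper≤q^v = subst (numProper q G ≤_) (length-allColorings q v)
                        (length-filter (proper? G) (allColorings q v))
  bound : numProper q G * (numEdges G + q ∸ 1) ≤ q ^ v * q'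
  bound = subst (λ m → numProper q G * m ≤ q ^ v * q') (cong (_∸ 1) (sym (+-suc (numEdges G) q')))
                (numProper-bound G q')
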